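{- For every target graph $H$ (connected, with at least three nodes, of constant size) satisfying $\operatorname{diam}(H) = 2$ and $\operatorname{rad}(H) = 1$, there is a deterministic one-round algorithm with bandwidth $O(1)$ for $\textsc{MemDetect}(H)$ under node deletions.
   Context: $\operatorname{diam}(H)$ and $\operatorname{rad}(H)$ are the diameter and radius (minimum eccentricity) of $H$. Dynamic network model: a sequence of graphs $G^0, G^1, \ldots$ with $n$ nodes initially, each obtained from the previous by at most one node deletion; nodes have distinct IDs, know their neighbors' IDs and initially the whole of $G^0$; communication is synchronous, each round the change happens first, then each node sends a $B$-bit message to each neighbor; nodes detect changes only via their neighbor lists. A one-round algorithm must output correctly for the current graph at the end of each round. $\textsc{MemDetect}(H)$: each node $v$ outputs whether $v$ belongs to some subgraph of the current graph isomorphic to $H$. -}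

module Defs where

open import Data.Nat using (ℕ; zero; suc; _≤_; _+_)
open import Data.Fin using (Fin)
open import Data.Bool using (Bool; true; false; _∧_; if_then_else_; T)
open import Data.Maybe using (Maybe; just; nothing)
open import Data.Vec using (Vec)
open import Data.Product using (Σ; ∃; _×_; ∃-syntax)
open import Relation.Binary.PropositionalEquality using (_≡_)
open import Relation.Nullary using (¬_)
open import Function.Definitions using (Injective)
open import Function.Bundles using (_⇔_)

record Graph (n : ℕ) : Set where
  field
    adj   : Fin n → Fin n → Bool
    sym   : ∀ u w → adj u w ≡ adj w u
    irrefl : ∀ u → adj u u ≡ false
open Graph public

data Walk {k : ℕ} (H : Graph k) : Fin k → Fin k → ℕ → Set where
  here : ∀ {u} → Walk H u u zero
  step : ∀ {u x w ℓ} → adj H u x ≡ true → Walk H x w ℓ → Walk H u w (suc ℓ)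

DistLe : ∀ {k} → Graph k → ℕ → Fin k → Fin k → Set
DistLe H d u w = ∃[ ℓ ] (ℓ ≤ d × Walk H u w ℓ)

Connected : ∀ {k} → Graph k → Set
Connected H = ∀ u w → ∃[ d ] DistLe H d u w

Ecc : ∀ {k} → Graph k → Fin k → ℕ → Set
Ecc H u e = (∀ w → DistLe H e u w) × (∀ d → (∀ w → DistLe H d u w) → e ≤ d)

HasDiameter : ∀ {k} → Graph k → ℕ → Set
HasDiameter H d = (∀ u w → DistLe H d u w)
                × (∀ d' → (∀ u w → DistLe H d' u w) → d ≤ d')

HasRadius : ∀ {k} → Graph k → ℕ → Set
HasRadius H r = (∃[ u ] Ecc H u r) × (∀ u e → Ecc H u e → r ≤ e)

-- Dynamic network under node deletions.
-- alive t v : node v is still present in G^t; G^t is the subgraph of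
-- G^0 induced on the alive nodes.  At most one deletion per step.

record DeletionSeq (n : ℕ) : Set where
  field
    alive      : ℕ → Fin n → Bool
    alive0     : ∀ v → alive zero v ≡ true
    monotone   : ∀ t v → alive (suc t) v ≡ true → alive t v ≡ true
    atMostOne  : ∀ t u w → alive t u ≡ true → alive (suc t) u ≡ false
                         → alive t w ≡ true → alive (suc t) w ≡ false → u ≡ w
open DeletionSeq public

curAdj : ∀ {n} → Graph n → DeletionSeq n → ℕ → Fin n → Fin n → Bool
curAdj G D t u w = alive D t u ∧ alive D t w ∧ adj G u w

-- MemDetect(H): v lies in some (not necessarily induced) subgraph of G^t
-- isomorphic to H, i.e. there is an injective edge-preserving map
-- from H into G^t whose image contains v.

InCopy : ∀ {k n} → Graph k → Graph n → DeletionSeq n → ℕ → Fin n → Set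
InCopy {k} {n} H G D t v =
  Σ (Fin k → Fin n) λ f →
      Injective _≡_ _≡_ f
    × (∀ i → alive D t (f i) ≡ true)
    × (∀ i j → adj H i j ≡ true → curAdj G D t (f i) (f j) ≡ true)
    × (∃[ i ] f i ≡ v)

-- Each round: the change happens,
-- each node sees its current neighbour list, sends a B-bit message to
-- each neighbour (computed from its state, its neighbour list and the
-- recipient), then updates its state from its state, its neighbour list
-- and the received messages (nothing from non-neighbours).

record Algorithm (n B : ℕ) : Set₁ where
  field
    State  : Set
    init   : Graph n → Fin n → State
    send   : State → (Fin n → Bool) → Fin n → Vec Bool B
    update : State → (Fin n → Bool) → (Fin n → Maybe (Vec Bool B)) → State
    output : State → Bool
open Algorithm public

-- state of node v at the end of round t (round 0 = initial state on G^0)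
run : ∀ {n B} → (A : Algorithm n B) → Graph n → DeletionSeq n → ℕ → Fin n → State A
run A G D zero v = init A G v
run A G D (suc t) v =
  update A (run A G D t v) (curAdj G D (suc t) v)
    (λ u → if curAdj G D (suc t) u v
             then just (send A (run A G D t u) (curAdj G D (suc t) u) v)
             else nothing)

SolvesMemDetect : ∀ {k n B} → Graph k → Algorithm n B → Set
SolvesMemDetect H A = ∀ G D t v → alive D t v ≡ true →
  (T (output A (run A G D t v)) ⇔ InCopy H G D t v)

-- Since rad(H) = 1, H has a vertex c₀ adjacent to all others.  In any copy of H
-- the image c of c₀ is then adjacent to every other vertex of the copy, so the
-- copy lies in the closed neighbourhood of c, and c recognises it from G⁰ and its
-- current neighbour list alone.  Hence v lies in a copy iff v is the centre of one,
-- or some current neighbour u is the centre of one containing v.  Each node u sends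
-- each neighbour w the single bit "some copy centred at u contains w", and v combines
-- its own check with the bits it receives; as both only depend on the current graph,
-- the output is correct after every round.
module Submission where

open import Defs hiding (sym)
open import Data.Nat using (ℕ; _≤_; zero; suc; s≤s)
open import Data.Bool using (Bool; true; false; _∧_; _∨_; if_then_else_; T; T?)
import Data.Bool.Properties as Boolₚ
open import Data.Fin using (Fin; _≟_)
open import Data.Fin.Properties using (any?; all?)
open import Data.Maybe using (Maybe; just; nothing; maybe)
open import Data.Vec as Vec using (Vec; [_])
open import Data.Vec.Functional using (_∷_; head; tail)
open import Data.Vec.Functional.Properties using (∷-cong)
open import Data.Product using (Σ; ∃; ∃-syntax; _×_; _,_; proj₂)
open import Data.Product.Function.Dependent.Propositional using (Σ-⇔)
open import Data.Sum using (_⊎_; inj₁; inj₂)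
open import Data.Sum.Function.Propositional using (_⊎-⇔_)
open import Data.Empty using (⊥-elim)
open import Function using (_∘_)
open import Function.Definitions using (Injective)
open import Function.Bundles using (_⇔_; mk⇔)
open import Function.Construct.Identity using (↠-id; ⇔-id)
import Function.Properties.Equivalence as ⇔
import Function.Related.Propositional as Related
open import Relation.Binary.Definitions using (_Respects_)
open import Relation.Binary.PropositionalEquality
  using (_≡_; _≢_; _≗_; refl; sym; trans; cong; subst; subst₂)
open import Relation.Nullary using (Dec; yes; no; does)
open import Relation.Nullary.Decidable
  using (⌊_⌋; map′; toWitness; fromWitness; _×-dec_; _→-dec_; _⊎-dec_)
open import Relation.Unary using (Decidable)

any?-Fin→ : ∀ k {n p} {P : (Fin k → Fin n) → Set p} →
  P Respects _≗_ → Decidable P → Dec (∃ P)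
any?-Fin→ zero {n} resp P? = map′ (empty ,_) (λ (f , p) → resp (λ ()) p) (P? empty)
  where
  empty : Fin 0 → Fin n
  empty ()
any?-Fin→ (suc k) resp P? =
  map′ (λ (x , f , p) → x ∷ f , p)
       (λ (f , p) → head f , tail f , resp (∷-cong refl λ _ → refl) p)
       (any? λ x → any?-Fin→ k (λ f≗g → resp (∷-cong refl f≗g)) (P? ∘ (x ∷_)))

dist≤1⇒≡⊎adj : ∀ {k} {H : Graph k} {c w} → DistLe H 1 c w → w ≡ c ⊎ adj H c w ≡ true
dist≤1⇒≡⊎adj (_ , _ , here)                  = inj₁ refl
dist≤1⇒≡⊎adj (_ , _ , step c~w here)         = inj₂ c~w
dist≤1⇒≡⊎adj (_ , s≤s () , step _ (step _ _))

inducedAdj : ∀ {n} → Graph n → (Fin n → Bool) → Fin n → Fin n → Bool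
inducedAdj G S u w = S u ∧ S w ∧ adj G u w

closedNbhd : ∀ {n} → (Fin n → Bool) → Fin n → Fin n → Bool
closedNbhd nbrs c x = does (x ≟ c) ∨ nbrs x

module Copies {k n} (H : Graph k) (G : Graph n) where

  IsCopy : (Fin n → Bool) → Fin n → (Fin k → Fin n) → Set
  IsCopy S v f = Injective _≡_ _≡_ f
               × (∀ i → S (f i) ≡ true)
               × (∀ i j → adj H i j ≡ true → inducedAdj G S (f i) (f j) ≡ true)
               × (∃[ i ] f i ≡ v)

  isCopy-mono : ∀ {S S′ v f} → (∀ i → S′ (f i) ≡ true) → IsCopy S v f → IsCopy S′ v f
  isCopy-mono {S} {S′} {f = f} f⊆S′ (injective , _ , edges , image) =
    injective , f⊆S′ , edges′ , image
    where
    edges′ : ∀ i j → adj H i j ≡ true → inducedAdj G S′ (f i) (f j) ≡ true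
    edges′ i j i~j rewrite f⊆S′ i | f⊆S′ j =
      Boolₚ.∧-conicalʳ (S (f j)) _ (Boolₚ.∧-conicalʳ (S (f i)) _ (edges i j i~j))

  isCopy-respects : ∀ {S v} → IsCopy S v Respects _≗_
  isCopy-respects {S} f≗g (injective , f⊆S , edges , (i , fi≡v)) =
    (λ {x} {y} gx≡gy → injective (trans (f≗g x) (trans gx≡gy (sym (f≗g y)))))
    , (λ i → subst (λ z → S z ≡ true) (f≗g i) (f⊆S i))
    , (λ i j i~j → subst₂ (λ a b → inducedAdj G S a b ≡ true) (f≗g i) (f≗g j) (edges i j i~j))
    , (i , trans (sym (f≗g i)) fi≡v)

  isCopy? : ∀ S v → Decidable (IsCopy S v)
  isCopy? S v f =
    map′ (λ inj {x} {y} → inj x y) (λ inj x y → inj)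
         (all? λ x → all? λ y → f x ≟ f y →-dec x ≟ y)
    ×-dec all? (λ i → S (f i) Boolₚ.≟ true)
    ×-dec (all? λ i → all? λ j →
             adj H i j Boolₚ.≟ true →-dec inducedAdj G S (f i) (f j) Boolₚ.≟ true)
    ×-dec any? (λ i → f i ≟ v)

  module Centred (c₀ : Fin k) (universal : ∀ i → i ≡ c₀ ⊎ adj H c₀ i ≡ true) where

    IsCentredCopy : (Fin n → Bool) → Fin n → Fin n → (Fin k → Fin n) → Set
    IsCentredCopy S c v f = IsCopy S v f × f c₀ ≡ c

    -- What node c can check knowing only G and its neighbour list nbrs.
    LocalCopy : (Fin n → Bool) → Fin n → Fin n → Set
    LocalCopy nbrs c v = ∃ (IsCentredCopy (closedNbhd nbrs c) c v)

    localCopy? : ∀ nbrs c v → Dec (LocalCopy nbrs c v)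
    localCopy? nbrs c v =
      any?-Fin→ k (λ f≗g (copy , centre) →
                     isCopy-respects {closedNbhd nbrs c} f≗g copy , trans (sym (f≗g c₀)) centre)
                  (λ f → isCopy? (closedNbhd nbrs c) v f ×-dec f c₀ ≟ c)

    centredCopy⊆closedNbhd : ∀ {S c v f} → IsCentredCopy S c v f →
      ∀ i → closedNbhd (inducedAdj G S c) c (f i) ≡ true
    centredCopy⊆closedNbhd {S} {c} {f = f} ((_ , _ , edges , _) , centre) i with f i ≟ c
    ... | yes _ = refl
    ... | no fi≢c with universal i
    ...   | inj₁ refl = ⊥-elim (fi≢c centre)
    ...   | inj₂ c₀~i = subst (λ z → inducedAdj G S z (f i) ≡ true) centre (edges c₀ i c₀~i)

    closedNbhd⊆ : ∀ {S c x} → S c ≡ true → closedNbhd (inducedAdj G S c) c x ≡ true → S x ≡ true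
    closedNbhd⊆ {S} {c} {x} c∈S x∈N with x ≟ c
    ... | yes refl = c∈S
    ... | no _     = Boolₚ.∧-conicalˡ (S x) _ (Boolₚ.∧-conicalʳ (S c) _ x∈N)

    centredCopy⇒localCopy : ∀ {S c v f} → IsCentredCopy S c v f → LocalCopy (inducedAdj G S c) c v
    centredCopy⇒localCopy {S} {c} {f = f} (copy , centre) =
      f , isCopy-mono {S} {closedNbhd (inducedAdj G S c) c}
                      (centredCopy⊆closedNbhd {S} (copy , centre)) copy
        , centre

    localCopy⇒copy : ∀ {S c v} → S c ≡ true → LocalCopy (inducedAdj G S c) c v → ∃ (IsCopy S v)
    localCopy⇒copy {S} {c} c∈S (f , copy@(_ , f⊆N , _) , _) =
      f , isCopy-mono {closedNbhd (inducedAdj G S c) c} {S} (closedNbhd⊆ {S} {c} c∈S ∘ f⊆N) copy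

    centre-adjacent : ∀ {S v f} → IsCopy S v f → f c₀ ≢ v → inducedAdj G S (f c₀) v ≡ true
    centre-adjacent {S} {f = f} (_ , _ , edges , (i , fi≡v)) fc₀≢v with universal i
    ... | inj₁ refl = ⊥-elim (fc₀≢v fi≡v)
    ... | inj₂ c₀~i = subst (λ z → inducedAdj G S (f c₀) z ≡ true) fi≡v (edges c₀ i c₀~i)

    LocalCopyNearby : (Fin n → Bool) → Fin n → Set
    LocalCopyNearby S v = LocalCopy (inducedAdj G S v) v v
                        ⊎ ∃ λ u → inducedAdj G S u v ≡ true × LocalCopy (inducedAdj G S u) u v

    copy⇔localCopyNearby : ∀ {S v} → S v ≡ true → ∃ (IsCopy S v) ⇔ LocalCopyNearby S v
    copy⇔localCopyNearby {S} {v} v∈S = mk⇔ to from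
      where
      to : ∃ (IsCopy S v) → LocalCopyNearby S v
      to (f , copy) with f c₀ ≟ v
      ... | yes centre = inj₁ (centredCopy⇒localCopy {S} (copy , centre))
      ... | no  fc₀≢v  =
        inj₂ (f c₀ , centre-adjacent {S} copy fc₀≢v , centredCopy⇒localCopy {S} (copy , refl))
      from : LocalCopyNearby S v → ∃ (IsCopy S v)
      from (inj₁ local)             = localCopy⇒copy {S} v∈S local
      from (inj₂ (u , u~v , local)) = localCopy⇒copy {S} (Boolₚ.∧-conicalˡ (S u) _ u~v) local

module Detector {k} (H : Graph k) (c₀ : Fin k) (universal : ∀ i → i ≡ c₀ ⊎ adj H c₀ i ≡ true)
                (n : ℕ) where

  open Copies {n = n} H using (IsCopy; isCopy?; isCopy-respects; isCopy-mono)
  module Local (G : Graph n) = Copies.Centred H G c₀ universal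
  open Local using (LocalCopy; localCopy?; copy⇔localCopyNearby)

  record NodeState : Set where
    constructor ⟨_,_,_⟩
    field
      graph   : Graph n
      self    : Fin n
      verdict : Bool
  open NodeState

  bit : Maybe (Vec Bool 1) → Bool
  bit = maybe Vec.head false

  verdict? : ∀ G v nbrs (msgs : Fin n → Maybe (Vec Bool 1)) →
    Dec (LocalCopy G nbrs v v ⊎ ∃ λ u → T (bit (msgs u)))
  verdict? G v nbrs msgs = localCopy? G nbrs v v ⊎-dec any? (T? ∘ bit ∘ msgs)

  detector : Algorithm n 1
  detector = record
    { State  = NodeState
    ; init   = λ G v →
        ⟨ G , v , ⌊ any?-Fin→ k (isCopy-respects G {λ _ → true} {v}) (isCopy? G (λ _ → true) v) ⌋ ⟩
    ; send   = λ s nbrs w → [ ⌊ localCopy? (graph s) nbrs (self s) w ⌋ ]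
    ; update = λ s nbrs msgs → ⟨ graph s , self s , ⌊ verdict? (graph s) (self s) nbrs msgs ⌋ ⟩
    ; output = verdict
    }

  run-graph : ∀ G D t v → graph (run detector G D t v) ≡ G
  run-graph G D zero    v = refl
  run-graph G D (suc t) v = run-graph G D t v

  run-self : ∀ G D t v → self (run detector G D t v) ≡ v
  run-self G D zero    v = refl
  run-self G D (suc t) v = run-self G D t v

  message : ∀ G D t u v → Maybe (Vec Bool 1)
  message G D t u v =
    if curAdj G D (suc t) u v
    then just (send detector (run detector G D t u) (curAdj G D (suc t) u) v)
    else nothing

  message-bit : ∀ G D t u v → T (bit (message G D t u v)) ⇔
    (curAdj G D (suc t) u v ≡ true × LocalCopy G (curAdj G D (suc t) u) u v)
  message-bit G D t u v
    with curAdj G D (suc t) u v | run detector G D t u | run-graph G D t u | run-self G D t u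
  ... | false | _               | _    | _    = mk⇔ (λ ()) (λ ())
  ... | true  | ⟨ .G , .u , _ ⟩ | refl | refl = mk⇔ (λ b → refl , toWitness b) (fromWitness ∘ proj₂)

  verdict-suc : ∀ G D t v → verdict (run detector G D (suc t) v)
              ≡ ⌊ verdict? G v (curAdj G D (suc t) v) (λ u → message G D t u v) ⌋
  verdict-suc G D t v rewrite run-graph G D t v | run-self G D t v = refl

  detector-solves : SolvesMemDetect H detector
  detector-solves G D zero v _ = ⇔.trans (mk⇔ toWitness fromWitness) copy-everywhere⇔copy-alive
    where
    copy-everywhere⇔copy-alive : ∃ (IsCopy G (λ _ → true) v) ⇔ InCopy H G D zero v
    copy-everywhere⇔copy-alive = mk⇔
      (λ (f , copy) → f , isCopy-mono G {λ _ → true} {alive D zero} (λ i → alive0 D (f i)) copy)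
      (λ (f , copy) → f , isCopy-mono G {alive D zero} {λ _ → true} (λ _ → refl) copy)
  detector-solves G D (suc t) v v-alive = begin
    T (verdict (run detector G D (suc t) v))
      ≡⟨ cong T (verdict-suc G D t v) ⟩
    T ⌊ verdict? G v (nbrs v) (λ u → message G D t u v) ⌋
      ∼⟨ mk⇔ toWitness fromWitness ⟩
    (LocalCopy G (nbrs v) v v ⊎ ∃ λ u → T (bit (message G D t u v)))
      ∼⟨ ⇔-id _ ⊎-⇔ Σ-⇔ (↠-id _) (message-bit G D t _ v) ⟩
    (LocalCopy G (nbrs v) v v ⊎ ∃ λ u → curAdj G D (suc t) u v ≡ true × LocalCopy G (nbrs u) u v)
      ∼⟨ ⇔.sym (copy⇔localCopyNearby G v-alive) ⟩
    InCopy H G D (suc t) v ∎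
    where
    open Related.EquationalReasoning
    nbrs : Fin n → Fin n → Bool
    nbrs = curAdj G D (suc t)

theorem6p7 : ∀ {k} (H : Graph k) → 3 ≤ k → Connected H → HasDiameter H 2 → HasRadius H 1 →
    ∃[ B ] ((n : ℕ) → Σ (Algorithm n B) λ A → SolvesMemDetect H A)
theorem6p7 H _ _ _ ((c₀ , c₀-within-1 , _) , _) =
  1 , λ n → detector n , detector-solves n
  where
  open Detector H c₀ (λ i → dist≤1⇒≡⊎adj (c₀-within-1 i))
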